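{- Let $\lambda$ be any partition, $z$ a content with $|z|=|\lambda|$, and $F,S$ cardinal fillings of shape $\lambda$ and content $z$. Let $1\le j<\lambda_1$, $p=\zeta_j$, and for $1\le l\le p$ let $F_l$ be the filling obtained from $F$ by exchanging the top entry of column $j+1$ with the $l$-th entry of column $j$ (so that $F-\sum_{l=1}^pF_l$ is a simple Plücker relation). Then $$R(F,S)-\sum_{l=1}^p R(F_l,S)=0.$$
   Context: Fix $n\ge 2$. A partition $\lambda$ is identified with its Young diagram with column lengths $\zeta_1\ge\cdots\ge\zeta_{\lambda_1}$; $(r,c)$ is the box in row $r$, column $c$. A filling of shape $\lambda$ assigns a value in $\{1,\dots,n\}$ to each box; its content $z=(z_1,\dots,z_n)$ counts occurrences of each value. Cardinal: no repeated value in a column. Same row content: for each row, the multisets of entries of that row agree. $\mathfrak{S}_\lambda=\prod_c\mathfrak{S}_{\zeta_c}$ (multipermutations) acts by $F_{\underline\pi}(r,c)=F(\pi_c(r),c)$, with $\mathrm{sgn}(\underline\pi)=\prod_c\mathrm{sgn}(\pi_c)$. The rearrangement coefficient of fillings $F,S$ of shape $\lambda$ and equal content is $R(F,S)=\sum\mathrm{sgn}(\underline\pi)$ over all $\underline\pi\in\mathfrak{S}_\lambda$ such that $F_{\underline\pi}$ has the same row content as $S$. -}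

module Defs where

open import Data.Nat as ℕ using (ℕ; zero; suc; _<_; _≤_; z≤n; s≤s)
open import Data.Fin as Fin using (Fin; toℕ; fromℕ<; _≟_)
open import Data.Fin.Properties using () renaming (_≟_ to _≟ᶠ_)
open import Data.Integer as ℤ using (ℤ; 0ℤ; 1ℤ; -_)
open import Data.List using (List; []; _∷_; map; concatMap; filter; length; foldr)
open import Data.List.Relation.Unary.All using (All)
open import Data.Bool using (Bool; true; false; if_then_else_; _∧_)
open import Data.Product using (_×_; _,_)
open import Relation.Nullary using (Dec; yes; no; ¬_)
open import Relation.Nullary.Decidable using (⌊_⌋)
open import Relation.Binary.PropositionalEquality using (_≡_; refl)

-- Partitions, given by their column lengths ζ₁ ≥ ζ₂ ≥ … ≥ ζ_{cols} > 0.
-- Columns are indexed 0-based by Fin cols; rows inside column c by Fin (ζ c),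
-- row 0 being the top row.

record Partition : Set where
  field
    cols       : ℕ                      -- number of columns (= first part)
    ζ        : Fin cols → ℕ
    weakDec  : ∀ (i j : Fin cols) → toℕ i ≤ toℕ j → ζ j ≤ ζ i
    positive : ∀ (i : Fin cols) → 0 < ζ i
open Partition public

sumℕ : List ℕ → ℕ
sumℕ = foldr ℕ._+_ 0

sumℤ : List ℤ → ℤ
sumℤ = foldr ℤ._+_ 0ℤ

allFin : ∀ k → List (Fin k)
allFin = Data.List.allFin
  where import Data.List

size : Partition → ℕ
size sh = sumℕ (map (ζ sh) (allFin (cols sh)))

-- A filling of shape sh with values in {1..n} (encoded as Fin n):
-- F c r is the entry in row r of column c.
record Filling (n : ℕ) (sh : Partition) : Set where
  constructor filling
  field
    entry : (c : Fin (cols sh)) → Fin (ζ sh c) → Fin n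
open Filling public

countᵇ : ∀ {A : Set} → (A → Bool) → List A → ℕ
countᵇ p xs = length (filter (λ x → Data.Bool._≟_ (p x) true) xs)
  where import Data.Bool

content : ∀ {n sh} → Filling n sh → Fin n → ℕ
content {n} {sh} F v =
  sumℕ (map (λ c → countᵇ (λ r → ⌊ entry F c r ≟ᶠ v ⌋) (allFin (ζ sh c))) (allFin (cols sh)))

∣_∣ᶜ : ∀ {n} → (Fin n → ℕ) → ℕ
∣_∣ᶜ {n} z = sumℕ (map z (allFin n))

Cardinal : ∀ {n sh} → Filling n sh → Set
Cardinal {n} {sh} F = ∀ (c : Fin (cols sh)) (r r' : Fin (ζ sh c)) → entry F c r ≡ entry F c r' → r ≡ r'

rowCount : ∀ {n sh} → Filling n sh → ℕ → Fin n → ℕ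
rowCount {n} {sh} F r v = countᵇ test (allFin (cols sh))
  where
    test : Fin (cols sh) → Bool
    test c with r ℕ.<? ζ sh c
    ... | yes r<ζ = ⌊ entry F c (fromℕ< r<ζ) ≟ᶠ v ⌋
    ... | no _    = false

-- same row content: every row has the same multiset of entries.
-- Rows r ≥ |λ| are empty, so checking r < |λ| decides all rows.
allᵇ : ∀ {A : Set} → (A → Bool) → List A → Bool
allᵇ p = foldr (λ x b → p x ∧ b) true

sameRowContentᵇ : ∀ {n sh} → Filling n sh → Filling n sh → Bool
sameRowContentᵇ {n} {sh} F S =
  allᵇ (λ r → allᵇ (λ v → ⌊ rowCount {n} {sh} F (toℕ r) v ℕ.≟ rowCount {n} {sh} S (toℕ r) v ⌋) (allFin n))
       (allFin (size sh))

-- Permutations of Fin k, enumerated as the injective self-maps.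

allFuns : ∀ k l → List (Fin k → Fin l)
allFuns zero    l = (λ ()) ∷ []
allFuns (suc k) l =
  concatMap (λ f → map (λ x → λ { Fin.zero → x ; (Fin.suc i) → f i }) (allFin l))
            (allFuns k l)

isInjectiveᵇ : ∀ {k} → (Fin k → Fin k) → Bool
isInjectiveᵇ {k} π =
  allᵇ (λ i → allᵇ (λ j → if ⌊ π i ≟ᶠ π j ⌋ then ⌊ i ≟ᶠ j ⌋ else true) (allFin k)) (allFin k)

perms : ∀ k → List (Fin k → Fin k)
perms k = filter (λ π → Data.Bool._≟_ (isInjectiveᵇ π) true) (allFuns k k)
  where import Data.Bool

signOfℕ : ℕ → ℤ
signOfℕ zero    = 1ℤ
signOfℕ (suc m) = - signOfℕ m

inversions : ∀ {k} → (Fin k → Fin k) → ℕ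
inversions {k} π =
  sumℕ (map (λ i → countᵇ (λ j → ⌊ i Fin.<? j ⌋ ∧ ⌊ π j Fin.<? π i ⌋) (allFin k)) (allFin k))

sgn : ∀ {k} → (Fin k → Fin k) → ℤ
sgn π = signOfℕ (inversions π)

MultiPerm : Partition → Set
MultiPerm sh = (c : Fin (cols sh)) → Fin (ζ sh c) → Fin (ζ sh c)

allDep : ∀ m (A : Fin m → Set) → ((c : Fin m) → List (A c)) → List ((c : Fin m) → A c)
allDep zero    A xs = (λ ()) ∷ []
allDep (suc m) A xs =
  concatMap (λ f → map (λ x → λ { Fin.zero → x ; (Fin.suc i) → f i }) (xs Fin.zero))
            (allDep m (λ i → A (Fin.suc i)) (λ i → xs (Fin.suc i)))

multiPerms : ∀ sh → List (MultiPerm sh)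
multiPerms sh = allDep (cols sh) (λ c → Fin (ζ sh c) → Fin (ζ sh c)) (λ c → perms (ζ sh c))

prodℤ : List ℤ → ℤ
prodℤ = foldr ℤ._*_ 1ℤ

sgnMulti : ∀ {sh} → MultiPerm sh → ℤ
sgnMulti {sh} π = prodℤ (map (λ c → sgn (π c)) (allFin (cols sh)))

act : ∀ {n sh} → Filling n sh → MultiPerm sh → Filling n sh
act F π = filling (λ c r → entry F c (π c r))

R : ∀ {n sh} → Filling n sh → Filling n sh → ℤ
R {n} {sh} F S =
  sumℤ (map (λ π → if sameRowContentᵇ {n} {sh} (act {n} {sh} F π) S then sgnMulti {sh} π else 0ℤ) (multiPerms sh))

exchange : ∀ {n sh} → Filling n sh → (a b : Fin (cols sh)) →
           Fin (ζ sh a) → Fin (ζ sh b) → Filling n sh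
exchange {n} {sh} F a b l t = filling e
  where
    e : (c : Fin (cols sh)) → Fin (ζ sh c) → Fin n
    e c r with c ≟ᶠ a
    ... | yes refl with r ≟ᶠ l
    ...   | yes _ = entry F b t
    ...   | no _  = entry F c r
    e c r | no _ with c ≟ᶠ b
    ... | yes refl with r ≟ᶠ t
    ...   | yes _ = entry F a l
    ...   | no _  = entry F c r
    e c r | no _ | no _ = entry F c r

top : ∀ sh (c : Fin (cols sh)) → Fin (ζ sh c)
top sh c = fromℕ< (positive sh c)

-- Write R(G, S) = Σ_π w_G(π), where w_G(π) is sgn π if G_π has the row content of S and 0
-- otherwise; the left-hand side is then a sum of ±w over pairs (x, π) with x ∈ {0, …, p}.
-- For a multipermutation π let r₀ be the row that π moves to the top of column j+1 and m the
-- entry index of column j that π puts in row r₀ (this row exists in column j since ζ_{j+1} ≤ ζ_j).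
-- Pair (0, π) with (m, π): F_m · π arises from F · π by swapping two boxes of row r₀.
-- Pair (l, π), l ≠ m, with (m, π′) where π′ composes column j of π with the transposition (l m):
-- again F_m · π′ and F_l · π differ by a swap inside row r₀, while sgn π′ = - sgn π.
-- This is a sign-reversing involution without fixed points, so the sum vanishes.

module Submission where

open import Defs
open import Level using (0ℓ)
open import Data.Nat as ℕ using (ℕ; zero; suc; _≤_; _+_)
import Data.Nat.Properties as ℕP
open import Data.Fin as Fin using (Fin; toℕ; fromℕ<; _<_)
import Data.Fin.Properties as FinP
open import Data.Fin.Permutation as Perm using (Permutation′; _⟨$⟩ʳ_)
open import Data.Fin.Permutation.Components using (transpose; transpose-inverse)
open import Data.Integer as ℤ using (ℤ; 0ℤ; -_; _-_; _*_)
import Data.Integer.Properties as ℤP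
open import Data.Bool using (Bool; true; false; if_then_else_; _∧_; not)
import Data.Bool as Bool
import Data.Bool.Properties as BoolP
open import Data.Maybe using (Maybe; just; nothing)
open import Data.List as List using (List; []; _∷_; map; concatMap; filter; length; tabulate; cartesianProductWith; cartesianProduct; _++_)
import Data.List.Properties as List
open import Data.List.Relation.Unary.All as All using (All; []; _∷_)
import Data.List.Relation.Unary.All.Properties as Allₚ
open import Data.List.Relation.Unary.Any as Any using (Any; here; there; _─_)
import Data.List.Relation.Unary.Any.Properties as Anyₚ
open import Data.List.Relation.Unary.AllPairs using (AllPairs; []; _∷_)
open import Data.List.Relation.Unary.Unique.Setoid using (Unique)
import Data.List.Relation.Unary.Unique.Setoid.Properties as Uniqueₚ
import Data.List.Relation.Unary.Unique.Propositional.Properties as Uniqueᵖ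
import Data.List.Membership.Setoid as Membership
import Data.List.Membership.Setoid.Properties as Membershipₚ
open import Data.List.Membership.Propositional.Properties using (∈-allFin)
open import Data.Product using (_×_; _,_; proj₁; proj₂; Σ; ∃₂)
open import Data.Product.Relation.Binary.Pointwise.NonDependent using (_×ₛ_)
open import Data.Unit using (⊤; tt)
open import Data.Empty using (⊥-elim)
open import Data.Vec.Functional using (removeAt; replicate)
open import Function using (_∘_; flip; _⇔_; mk⇔; Equivalence)
open import Function.Definitions using (Injective)
import Function.Construct.Composition as Composition
open import Relation.Binary using (Setoid; _Preserves₂_⟶_⟶_; _Respects_)
open import Relation.Binary.Definitions using (tri<; tri≈; tri>)
open import Relation.Binary.PropositionalEquality as ≡ using (_≡_; _≢_; _≗_; refl; sym; trans; cong; cong₂; subst; subst₂)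
open import Relation.Nullary using (¬_; Dec; yes; no; _×-dec_)
open import Relation.Nullary.Decidable using (⌊_⌋)
open import Relation.Unary using (Pred; Decidable; _∩_; _≐_)
import Algebra.Properties.CommutativeMonoid.Sum as CommutativeMonoidSum

isYes-true : ∀ {A : Set} (a? : Dec A) → A → ⌊ a? ⌋ ≡ true
isYes-true (yes _) _ = refl
isYes-true (no ¬a) a = ⊥-elim (¬a a)

isYes-false : ∀ {A : Set} (a? : Dec A) → ¬ A → ⌊ a? ⌋ ≡ false
isYes-false (yes a) ¬a = ⊥-elim (¬a a)
isYes-false (no _)  _  = refl

isYes-⇔ : ∀ {A B : Set} (a? : Dec A) (b? : Dec B) → (A → B) → (B → A) → ⌊ a? ⌋ ≡ ⌊ b? ⌋
isYes-⇔ (yes a) b? a→b _   = sym (isYes-true b? (a→b a))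
isYes-⇔ (no ¬a) b? _   b→a = sym (isYes-false b? (¬a ∘ b→a))

allᵇ-allFin⁺ : ∀ {k} (p : Fin k → Bool) → (∀ i → p i ≡ true) → allᵇ p (allFin k) ≡ true
allᵇ-allFin⁺ p = go ∘ Allₚ.tabulate⁺
  where
  go : ∀ {xs} → All (λ x → p x ≡ true) xs → allᵇ p xs ≡ true
  go []          = refl
  go (px ∷ pxs) rewrite px = go pxs

allᵇ-allFin⁻ : ∀ {k} (p : Fin k → Bool) → allᵇ p (allFin k) ≡ true → ∀ i → p i ≡ true
allᵇ-allFin⁻ p = Allₚ.tabulate⁻ ∘ go _
  where
  go : ∀ xs → allᵇ p xs ≡ true → All (λ x → p x ≡ true) xs
  go []       _ = []
  go (x ∷ xs) h with p x in px
  ... | true = px ∷ go xs h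

implicationᵇ⁺ : ∀ {A B : Set} (a? : Dec A) (b? : Dec B) → (A → B) → (if ⌊ a? ⌋ then ⌊ b? ⌋ else true) ≡ true
implicationᵇ⁺ (no _)  _       _   = refl
implicationᵇ⁺ (yes a) (yes _) _   = refl
implicationᵇ⁺ (yes a) (no ¬b) a→b = ⊥-elim (¬b (a→b a))

implicationᵇ⁻ : ∀ {A B : Set} (a? : Dec A) (b? : Dec B) → (if ⌊ a? ⌋ then ⌊ b? ⌋ else true) ≡ true → A → B
implicationᵇ⁻ (yes _) (yes b) _ _ = b
implicationᵇ⁻ (no ¬a) _       _ a = ⊥-elim (¬a a)

isInjectiveᵇ⇔Injective : ∀ {k} (σ : Fin k → Fin k) → isInjectiveᵇ σ ≡ true ⇔ Injective _≡_ _≡_ σ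
isInjectiveᵇ⇔Injective σ = mk⇔
  (λ σ! {i} {j} → implicationᵇ⁻ (σ i Fin.≟ σ j) (i Fin.≟ j) (allᵇ-allFin⁻ _ (allᵇ-allFin⁻ _ σ! i) j))
  (λ σ-inj → allᵇ-allFin⁺ _ λ i → allᵇ-allFin⁺ _ λ j → implicationᵇ⁺ (σ i Fin.≟ σ j) (i Fin.≟ j) σ-inj)

sumℤ-++ : ∀ xs ys → sumℤ (xs ++ ys) ≡ sumℤ xs ℤ.+ sumℤ ys
sumℤ-++ []       ys = sym (ℤP.+-identityˡ _)
sumℤ-++ (x ∷ xs) ys = trans (cong (ℤ._+_ x) (sumℤ-++ xs ys)) (sym (ℤP.+-assoc x _ _))

sumℤ-map-neg : ∀ {A : Set} (f : A → ℤ) xs → sumℤ (map (λ x → - f x) xs) ≡ - sumℤ (map f xs)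
sumℤ-map-neg f []       = refl
sumℤ-map-neg f (x ∷ xs) = trans (cong (ℤ._+_ (- f x)) (sumℤ-map-neg f xs)) (sym (ℤP.neg-distrib-+ (f x) _))

sumℤ-cartesianProductWith : ∀ {A B C : Set} (W : C → ℤ) (f : A → B → C) xs ys →
  sumℤ (map W (cartesianProductWith f xs ys)) ≡ sumℤ (map (λ x → sumℤ (map (W ∘ f x) ys)) xs)
sumℤ-cartesianProductWith W f []       ys = refl
sumℤ-cartesianProductWith W f (x ∷ xs) ys = begin
  sumℤ (map W (map (f x) ys ++ cartesianProductWith f xs ys))
    ≡⟨ cong sumℤ (List.map-++ W (map (f x) ys) _) ⟩
  sumℤ (map W (map (f x) ys) ++ map W (cartesianProductWith f xs ys))
    ≡⟨ sumℤ-++ (map W (map (f x) ys)) _ ⟩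
  sumℤ (map W (map (f x) ys)) ℤ.+ sumℤ (map W (cartesianProductWith f xs ys))
    ≡⟨ cong₂ ℤ._+_ (cong sumℤ (sym (List.map-∘ ys))) (sumℤ-cartesianProductWith W f xs ys) ⟩
  sumℤ (map (W ∘ f x) ys) ℤ.+ sumℤ (map (λ x → sumℤ (map (W ∘ f x) ys)) xs) ∎
  where open ≡.≡-Reasoning

sumℤ-─ : ∀ {A : Set} {P : Pred A 0ℓ} (W : A → ℤ) {xs} (p : Any P xs) →
  sumℤ (map W xs) ≡ W (Any.lookup p) ℤ.+ sumℤ (map W (xs ─ p))
sumℤ-─ W (here _)          = refl
sumℤ-─ W {x ∷ xs} (there p) = begin
  W x ℤ.+ sumℤ (map W xs)                     ≡⟨ cong (ℤ._+_ (W x)) (sumℤ-─ W p) ⟩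
  W x ℤ.+ (W (Any.lookup p) ℤ.+ sumℤ (map W (xs ─ p)))  ≡⟨ sym (ℤP.+-assoc (W x) _ _) ⟩
  W x ℤ.+ W (Any.lookup p) ℤ.+ sumℤ (map W (xs ─ p))    ≡⟨ cong (λ w → w ℤ.+ sumℤ (map W (xs ─ p))) (ℤP.+-comm (W x) _) ⟩
  W (Any.lookup p) ℤ.+ W x ℤ.+ sumℤ (map W (xs ─ p))    ≡⟨ ℤP.+-assoc (W (Any.lookup p)) (W x) _ ⟩
  W (Any.lookup p) ℤ.+ (W x ℤ.+ sumℤ (map W (xs ─ p))) ∎
  where open ≡.≡-Reasoning

concatMap-map : ∀ {A B C : Set} (f : A → B → C) xs ys →
  concatMap (λ x → map (f x) ys) xs ≡ cartesianProductWith f xs ys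
concatMap-map f []       ys = refl
concatMap-map f (x ∷ xs) ys = cong (map (f x) ys ++_) (concatMap-map f xs ys)

module _ {A : Set} {R : A → A → Set} {P : Pred A 0ℓ} where

  AllPairs-─ : ∀ {xs} (p : Any P xs) → AllPairs R xs → AllPairs R (xs ─ p)
  AllPairs-─ (here _)  (_ ∷ rs)  = rs
  AllPairs-─ (there p) (r ∷ rs) = Allₚ.─⁺ p r ∷ AllPairs-─ p rs

  AllPairs-lookup-─ : (∀ {x y} → R x y → R y x) → ∀ {xs} (p : Any P xs) → AllPairs R xs →
    All (λ y → R y (Any.lookup p)) (xs ─ p)
  AllPairs-lookup-─ R-sym (here _)  (r ∷ _)  = All.map R-sym r
  AllPairs-lookup-─ R-sym (there p) (r ∷ rs) = proj₁ (All.lookupAny r p) ∷ AllPairs-lookup-─ R-sym p rs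

module _ (S : Setoid 0ℓ 0ℓ) where
  open Setoid S
  open Membership S using (_∈_)

  ∈-─ : ∀ {P : Pred Carrier 0ℓ} {y xs} (p : Any P xs) → y ∈ xs → ¬ y ≈ Any.lookup p → y ∈ (xs ─ p)
  ∈-─ (here _)  (here y≈x)  y≉ = ⊥-elim (y≉ y≈x)
  ∈-─ (here _)  (there y∈)  y≉ = y∈
  ∈-─ (there p) (here y≈x)  y≉ = here y≈x
  ∈-─ (there p) (there y∈)  y≉ = there (∈-─ p y∈ y≉)

-- Enumerations up to a setoid equality

record Enumerates (S : Setoid 0ℓ 0ℓ) (P : Pred (Setoid.Carrier S) 0ℓ) (xs : List (Setoid.Carrier S)) : Set where
  open Membership S using (_∈_)
  field
    sound    : All P xs
    complete : ∀ {x} → P x → x ∈ xs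
    unique   : Unique S xs

open Enumerates

Enumerates-resp-≐ : ∀ {S P Q xs} → P ≐ Q → Enumerates S P xs → Enumerates S Q xs
Enumerates-resp-≐ (P⊆Q , Q⊆P) xs-enum = record
  { sound    = All.map P⊆Q (sound xs-enum)
  ; complete = complete xs-enum ∘ Q⊆P
  ; unique   = unique xs-enum
  }

Π-setoid : ∀ {m} → (Fin m → Setoid 0ℓ 0ℓ) → Setoid 0ℓ 0ℓ
Π-setoid S = record
  { Carrier       = ∀ c → Setoid.Carrier (S c)
  ; _≈_           = λ f g → ∀ c → Setoid._≈_ (S c) (f c) (g c)
  ; isEquivalence = record
    { refl  = λ c → Setoid.refl (S c)
    ; sym   = λ f≈g c → Setoid.sym (S c) (f≈g c)
    ; trans = λ f≈g g≈h c → Setoid.trans (S c) (f≈g c) (g≈h c)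
    }
  }

allFin-enumerates : ∀ k → Enumerates (≡.setoid (Fin k)) (λ _ → ⊤) (allFin k)
allFin-enumerates k = record
  { sound    = All.universal (λ _ → tt) (allFin k)
  ; complete = λ {i} _ → ∈-allFin i
  ; unique   = Uniqueᵖ.allFin⁺ k
  }

module _ {S T U : Setoid 0ℓ 0ℓ}
  {P : Pred (Setoid.Carrier S) 0ℓ} {Q : Pred (Setoid.Carrier T) 0ℓ} {R : Pred (Setoid.Carrier U) 0ℓ}
  {xs : List (Setoid.Carrier S)} {ys : List (Setoid.Carrier T)}
  (f : Setoid.Carrier S → Setoid.Carrier T → Setoid.Carrier U) where
  open Setoid S using () renaming (_≈_ to _≈₁_)
  open Setoid T using () renaming (_≈_ to _≈₂_)
  open Setoid U using () renaming (_≈_ to _≈₃_)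

  cartesianProductWith-enumerates :
    f Preserves₂ _≈₁_ ⟶ _≈₂_ ⟶ _≈₃_ →
    (∀ {a b c d} → f a b ≈₃ f c d → a ≈₁ c × b ≈₂ d) →
    (∀ {a b} → P a → Q b → R (f a b)) →
    (∀ {u} → R u → ∃₂ λ a b → P a × Q b × u ≈₃ f a b) →
    Enumerates S P xs → Enumerates T Q ys → Enumerates U R (cartesianProductWith f xs ys)
  cartesianProductWith-enumerates f-cong f-injective f-sound f-split xs-enum ys-enum = record
    { sound    = sound′ (sound xs-enum)
    ; complete = λ Ru → let a , b , Pa , Qb , u≈fab = f-split Ru in
        Membershipₚ.∈-resp-≈ U (Setoid.sym U u≈fab)
          (Membershipₚ.∈-cartesianProductWith⁺ S T U f-cong (complete xs-enum Pa) (complete ys-enum Qb))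
    ; unique   = Uniqueₚ.cartesianProductWith⁺ S T U f f-injective (unique xs-enum) (unique ys-enum)
    }
    where
    sound′ : ∀ {as} → All P as → All R (cartesianProductWith f as ys)
    sound′ []         = []
    sound′ (Pa ∷ Pas) = Allₚ.++⁺ (Allₚ.map⁺ (All.map (f-sound Pa) (sound ys-enum))) (sound′ Pas)

module _ {m} (S : Fin (suc m) → Setoid 0ℓ 0ℓ) {P : ∀ c → Pred (Setoid.Carrier (S c)) 0ℓ}
  {hs : List (Setoid.Carrier (S Fin.zero))} {ts : List (Setoid.Carrier (Π-setoid (S ∘ Fin.suc)))}
  (cons : Setoid.Carrier (Π-setoid (S ∘ Fin.suc)) → Setoid.Carrier (S Fin.zero) → Setoid.Carrier (Π-setoid S))
  (cons-zero : ∀ f x → cons f x Fin.zero ≡ x) (cons-suc : ∀ f x i → cons f x (Fin.suc i) ≡ f i)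
  where
  open Setoid using () renaming (refl to ≈-refl; trans to ≈-trans; reflexive to ≈-reflexive)

  private
    ≈cons⁻ : ∀ {f x g} → Setoid._≈_ (Π-setoid S) g (cons f x) →
             Setoid._≈_ (S Fin.zero) (g Fin.zero) x × Setoid._≈_ (Π-setoid (S ∘ Fin.suc)) (g ∘ Fin.suc) f
    ≈cons⁻ {f} {x} g≈ =
      ≈-trans (S _) (g≈ Fin.zero) (≈-reflexive (S _) (cons-zero f x)) ,
      λ i → ≈-trans (S _) (g≈ (Fin.suc i)) (≈-reflexive (S _) (cons-suc f x i))

    ≈cons⁺ : ∀ {f x g} → Setoid._≈_ (S Fin.zero) (g Fin.zero) x → Setoid._≈_ (Π-setoid (S ∘ Fin.suc)) (g ∘ Fin.suc) f →
             Setoid._≈_ (Π-setoid S) g (cons f x)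
    ≈cons⁺ {f} {x} g₀≈x g₊≈f Fin.zero    = ≈-trans (S _) g₀≈x (≈-reflexive (S _) (sym (cons-zero f x)))
    ≈cons⁺ {f} {x} g₀≈x g₊≈f (Fin.suc i) = ≈-trans (S _) (g₊≈f i) (≈-reflexive (S _) (sym (cons-suc f x i)))

  cons-enumerates : Enumerates (Π-setoid (S ∘ Fin.suc)) (λ f → ∀ c → P (Fin.suc c) (f c)) ts →
    Enumerates (S Fin.zero) (P Fin.zero) hs →
    Enumerates (Π-setoid S) (λ f → ∀ c → P c (f c)) (concatMap (λ f → map (cons f) hs) ts)
  cons-enumerates ts-enum hs-enum = subst (Enumerates _ _) (sym (concatMap-map cons ts hs))
    (cartesianProductWith-enumerates cons cons-cong cons-injective cons-sound cons-split ts-enum hs-enum)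
    where
    cons-cong : ∀ {f g x y} → Setoid._≈_ (Π-setoid (S ∘ Fin.suc)) f g → Setoid._≈_ (S Fin.zero) x y →
                Setoid._≈_ (Π-setoid S) (cons f x) (cons g y)
    cons-cong {f} {x = x} f≈g x≈y = ≈cons⁺ (≈-trans (S _) (≈-reflexive (S _) (cons-zero f x)) x≈y)
                                          (λ i → ≈-trans (S _) (≈-reflexive (S _) (cons-suc f x i)) (f≈g i))
    cons-injective : ∀ {f x g y} → Setoid._≈_ (Π-setoid S) (cons f x) (cons g y) →
                     Setoid._≈_ (Π-setoid (S ∘ Fin.suc)) f g × Setoid._≈_ (S Fin.zero) x y
    cons-injective {f} {x} fx≈gy =
      (λ i → ≈-trans (S _) (≈-reflexive (S _) (sym (cons-suc f x i))) (proj₂ (≈cons⁻ fx≈gy) i)) ,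
      ≈-trans (S _) (≈-reflexive (S _) (sym (cons-zero f x))) (proj₁ (≈cons⁻ fx≈gy))
    cons-sound : ∀ {f x} → (∀ c → P (Fin.suc c) (f c)) → P Fin.zero x → ∀ c → P c (cons f x c)
    cons-sound {f} {x} Pf Px Fin.zero    = subst (P Fin.zero) (sym (cons-zero f x)) Px
    cons-sound {f} {x} Pf Px (Fin.suc i) = subst (P (Fin.suc i)) (sym (cons-suc f x i)) (Pf i)
    cons-split : ∀ {g} → (∀ c → P c (g c)) → ∃₂ λ f x → (∀ c → P (Fin.suc c) (f c)) × P Fin.zero x ×
                 Setoid._≈_ (Π-setoid S) g (cons f x)
    cons-split {g} Pg = g ∘ Fin.suc , g Fin.zero , Pg ∘ Fin.suc , Pg Fin.zero ,
                        ≈cons⁺ (≈-refl (S _)) (≈-refl (Π-setoid (S ∘ Fin.suc)))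

Fun-setoid : ℕ → ℕ → Setoid 0ℓ 0ℓ
Fun-setoid k l = Π-setoid {k} (λ _ → ≡.setoid (Fin l))

allFuns-enumerates : ∀ k l → Enumerates (Fun-setoid k l) (λ _ → ⊤) (allFuns k l)
allFuns-enumerates zero    l = record { sound = tt ∷ [] ; complete = λ _ → here (λ ()) ; unique = [] ∷ [] }
allFuns-enumerates (suc k) l = Enumerates-resp-≐ ((λ _ → tt) , (λ _ _ → tt))
  (cons-enumerates (λ _ → ≡.setoid (Fin l)) _ (λ _ _ → refl) (λ _ _ _ → refl)
    (Enumerates-resp-≐ ((λ _ _ → tt) , (λ _ → tt)) (allFuns-enumerates k l)) (allFin-enumerates l))

allDep-enumerates : ∀ m (S : Fin m → Setoid 0ℓ 0ℓ) {P : ∀ c → Pred (Setoid.Carrier (S c)) 0ℓ} xs →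
  (∀ c → Enumerates (S c) (P c) (xs c)) →
  Enumerates (Π-setoid S) (λ f → ∀ c → P c (f c)) (allDep m (λ c → Setoid.Carrier (S c)) xs)
allDep-enumerates zero    S xs _       = record { sound = (λ ()) ∷ [] ; complete = λ _ → here (λ ()) ; unique = [] ∷ [] }
allDep-enumerates (suc m) S {P} xs xs-enum = cons-enumerates S {P} _ (λ _ _ → refl) (λ _ _ _ → refl)
  (allDep-enumerates m (S ∘ Fin.suc) (xs ∘ Fin.suc) (xs-enum ∘ Fin.suc)) (xs-enum Fin.zero)

filter-enumerates : ∀ {S P Q xs} (Q? : Decidable Q) → Q Respects (Setoid._≈_ S) →
  Enumerates S P xs → Enumerates S (P ∩ Q) (filter Q? xs)
filter-enumerates {S} {xs = xs} Q? Q-resp xs-enum = record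
  { sound    = All.zip (Allₚ.filter⁺ Q? (sound xs-enum) , Allₚ.all-filter Q? xs)
  ; complete = λ (Px , Qx) → Membershipₚ.∈-filter⁺ S Q? Q-resp (complete xs-enum Px) Qx
  ; unique   = Uniqueₚ.filter⁺ S Q? (unique xs-enum)
  }

perms-enumerates : ∀ k → Enumerates (Fun-setoid k k) (Injective _≡_ _≡_) (perms k)
perms-enumerates k = Enumerates-resp-≐ (to ∘ proj₂ , λ σ-inj → tt , from σ-inj)
  (filter-enumerates (λ σ → isInjectiveᵇ σ Bool.≟ true) resp (allFuns-enumerates k k))
  where
  to : ∀ {σ : Fin k → Fin k} → isInjectiveᵇ σ ≡ true → Injective _≡_ _≡_ σ
  to = Equivalence.to (isInjectiveᵇ⇔Injective _)
  from : ∀ {σ : Fin k → Fin k} → Injective _≡_ _≡_ σ → isInjectiveᵇ σ ≡ true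
  from = Equivalence.from (isInjectiveᵇ⇔Injective _)
  resp : (λ σ → isInjectiveᵇ σ ≡ true) Respects Setoid._≈_ (Fun-setoid k k)
  resp σ≗τ σ! = from λ τi≡τj → to σ! (trans (σ≗τ _) (trans τi≡τj (sym (σ≗τ _))))

MultiPerm-setoid : Partition → Setoid 0ℓ 0ℓ
MultiPerm-setoid sh = Π-setoid (λ c → Fun-setoid (ζ sh c) (ζ sh c))

IsMultiPerm : ∀ {sh} → MultiPerm sh → Set
IsMultiPerm π = ∀ c → Injective _≡_ _≡_ (π c)

multiPerms-enumerates : ∀ sh → Enumerates (MultiPerm-setoid sh) (IsMultiPerm {sh}) (multiPerms sh)
multiPerms-enumerates sh = allDep-enumerates (cols sh) _ (λ c → perms (ζ sh c)) (λ c → perms-enumerates (ζ sh c))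

-- Sign-reversing involutions

module SignReversingInvolution
  (S : Setoid 0ℓ 0ℓ)
  (P : Pred (Setoid.Carrier S) 0ℓ) (W : Setoid.Carrier S → ℤ) (ι : Setoid.Carrier S → Setoid.Carrier S)
  (W-cong         : ∀ {x y} → Setoid._≈_ S x y → W x ≡ W y)
  (ι-closed       : ∀ x → P x → P (ι x))
  (ι-cong         : ∀ x {y} → P x → Setoid._≈_ S x y → Setoid._≈_ S (ι x) (ι y))
  (ι-involutive   : ∀ x → P x → Setoid._≈_ S (ι (ι x)) x)
  (ι-fixpointFree : ∀ x → P x → ¬ Setoid._≈_ S (ι x) x)
  (W-ι            : ∀ x → P x → W (ι x) ≡ - W x)
  where

  open Setoid S using (_≈_) renaming (sym to ≈-sym; trans to ≈-trans)
  open Membership S using (_∈_)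

  private
    sum≡0 : ∀ k xs → length xs ≤ k → All P xs → Unique S xs → All (λ x → ι x ∈ xs) xs →
            sumℤ (map W xs) ≡ 0ℤ
    sum≡0 _       []       _         _          _          _                  = refl
    sum≡0 zero    (_ ∷ _)  ()        _          _          _
    sum≡0 (suc k) (x ∷ xs) (ℕ.s≤s ∣xs∣≤k) (Px ∷ Pxs) (x≉xs ∷ xs!) (here ιx≈x ∷ _) =
      ⊥-elim (ι-fixpointFree x Px ιx≈x)
    sum≡0 (suc k) (x ∷ xs) (ℕ.s≤s ∣xs∣≤k) (Px ∷ Pxs) (x≉xs ∷ xs!) (there ιx∈xs ∷ ιxs∈) = begin
      W x ℤ.+ sumℤ (map W xs)                ≡⟨ cong (ℤ._+_ (W x)) (sumℤ-─ W ιx∈xs) ⟩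
      W x ℤ.+ (W z ℤ.+ sumℤ (map W rest))    ≡⟨ sym (ℤP.+-assoc (W x) (W z) _) ⟩
      W x ℤ.+ W z ℤ.+ sumℤ (map W rest)      ≡⟨ cong (λ w → W x ℤ.+ w ℤ.+ sumℤ (map W rest)) Wz≡-Wx ⟩
      W x ℤ.+ - W x ℤ.+ sumℤ (map W rest)    ≡⟨ cong (λ w → w ℤ.+ sumℤ (map W rest)) (ℤP.+-inverseʳ (W x)) ⟩
      0ℤ ℤ.+ sumℤ (map W rest)               ≡⟨ ℤP.+-identityˡ _ ⟩
      sumℤ (map W rest)                      ≡⟨ sum≡0 k rest ∣rest∣≤k (Allₚ.─⁺ ιx∈xs Pxs) (AllPairs-─ ιx∈xs xs!) rest-closed ⟩
      0ℤ ∎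
      where
      open ≡.≡-Reasoning
      z    = Any.lookup ιx∈xs
      rest = xs ─ ιx∈xs
      ιx≈z : ι x ≈ z
      ιx≈z = Anyₚ.lookup-result ιx∈xs
      Wz≡-Wx : W z ≡ - W x
      Wz≡-Wx = trans (sym (W-cong ιx≈z)) (W-ι x Px)
      ∣rest∣≤k : length rest ≤ k
      ∣rest∣≤k = ℕP.≤-trans (ℕP.≤-reflexive (List.length-removeAt xs (Any.index ιx∈xs)))
                           (ℕP.≤-trans ℕP.pred[n]≤n ∣xs∣≤k)
      stays : ∀ {y} → P y → ¬ x ≈ y → ¬ y ≈ z → ι y ∈ (x ∷ xs) → ι y ∈ rest
      stays {y} Py x≉y y≉z (here ιy≈x) =
        ⊥-elim (y≉z (≈-trans (≈-sym (ι-involutive y Py)) (≈-trans (ι-cong (ι y) (ι-closed y Py) ιy≈x) ιx≈z)))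
      stays {y} Py x≉y y≉z (there ιy∈xs) = ∈-─ S ιx∈xs ιy∈xs λ ιy≈z →
        x≉y (≈-trans (≈-sym (ι-involutive x Px))
               (≈-trans (ι-cong (ι x) (ι-closed x Px) (≈-trans ιx≈z (≈-sym ιy≈z))) (ι-involutive y Py)))
      rest-closed : All (λ y → ι y ∈ rest) rest
      rest-closed = All.zipWith (λ { ((Py , x≉y , ιy∈) , y≉z) → stays Py x≉y y≉z ιy∈ })
        (Allₚ.─⁺ ιx∈xs (All.zip (Pxs , All.zip (x≉xs , ιxs∈))) , AllPairs-lookup-─ (_∘ ≈-sym) ιx∈xs xs!)

  sumℤ≡0 : ∀ {xs} → Enumerates S P xs → sumℤ (map W xs) ≡ 0ℤ
  sumℤ≡0 {xs} xs-enum = sum≡0 (length xs) xs ℕP.≤-refl (sound xs-enum) (unique xs-enum)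
    (All.map (λ {x} → complete xs-enum ∘ ι-closed x) (sound xs-enum))

-- Signs of permutations

module ℕΣ = CommutativeMonoidSum ℕP.+-0-commutativeMonoid
open ℕΣ using (sum)

indicator : Bool → ℕ
indicator true  = 1
indicator false = 0

sumℕ-tabulate : ∀ {k} (f : Fin k → ℕ) → sumℕ (tabulate f) ≡ sum f
sumℕ-tabulate {zero}  f = refl
sumℕ-tabulate {suc k} f = cong (f Fin.zero +_) (sumℕ-tabulate (f ∘ Fin.suc))

sumℕ-allFin : ∀ {k} (f : Fin k → ℕ) → sumℕ (map f (allFin k)) ≡ sum f
sumℕ-allFin f = trans (cong sumℕ (List.map-tabulate (λ i → i) f)) (sumℕ-tabulate f)

countᵇ≡sumℕ : ∀ {A : Set} (p : A → Bool) xs → countᵇ p xs ≡ sumℕ (map (indicator ∘ p) xs)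
countᵇ≡sumℕ p []       = refl
countᵇ≡sumℕ p (x ∷ xs) with p x
... | true  = cong suc (countᵇ≡sumℕ p xs)
... | false = countᵇ≡sumℕ p xs

countᵇ-allFin : ∀ {k} (p : Fin k → Bool) → countᵇ p (allFin k) ≡ sum (indicator ∘ p)
countᵇ-allFin p = trans (countᵇ≡sumℕ p (allFin _)) (sumℕ-allFin (indicator ∘ p))

sum-point : ∀ {k} (f : Fin k → ℕ) a → (∀ i → i ≢ a → f i ≡ 0) → sum f ≡ f a
sum-point {suc k} f a f≡0 = begin
  sum f                               ≡⟨ ℕΣ.sum-remove f ⟩
  f a + sum (removeAt f a)            ≡⟨ cong (f a +_) (ℕΣ.sum-cong-≗ (λ i → f≡0 _ (FinP.punchInᵢ≢i a i))) ⟩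
  f a + sum (replicate k 0)           ≡⟨ cong (f a +_) (ℕΣ.sum-replicate-zero k) ⟩
  f a + 0                             ≡⟨ ℕP.+-identityʳ (f a) ⟩
  f a ∎
  where open ≡.≡-Reasoning

transpose-matchˡ : ∀ {k} (i j : Fin k) → transpose i j i ≡ j
transpose-matchˡ i j with i Fin.≟ i
... | yes _  = refl
... | no i≢i = ⊥-elim (i≢i refl)

transpose-matchʳ : ∀ {k} (i j : Fin k) → transpose i j j ≡ i
transpose-matchʳ i j with j Fin.≟ i
... | yes j≡i = j≡i
... | no _ with j Fin.≟ j
...   | yes _  = refl
...   | no j≢j = ⊥-elim (j≢j refl)

transpose-other : ∀ {k} {i j x : Fin k} → x ≢ i → x ≢ j → transpose i j x ≡ x
transpose-other {i = i} {j} {x} x≢i x≢j with x Fin.≟ i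
... | yes x≡i = ⊥-elim (x≢i x≡i)
... | no _ with x Fin.≟ j
...   | yes x≡j = ⊥-elim (x≢j x≡j)
...   | no _    = refl

transpose-comm : ∀ {k} (i j x : Fin k) → transpose i j x ≡ transpose j i x
transpose-comm i j x = cases (x Fin.≟ i) (x Fin.≟ j)
  where
  cases : Dec (x ≡ i) → Dec (x ≡ j) → transpose i j x ≡ transpose j i x
  cases (yes refl) _        = trans (transpose-matchˡ x j) (sym (transpose-matchʳ j x))
  cases (no _)     (yes refl) = trans (transpose-matchʳ i x) (sym (transpose-matchˡ x i))
  cases (no x≢i)   (no x≢j)   = trans (transpose-other x≢i x≢j) (sym (transpose-other x≢j x≢i))

transpose-involutive : ∀ {k} (i j x : Fin k) → transpose i j (transpose i j x) ≡ x
transpose-involutive i j x = trans (cong (transpose i j) (transpose-comm i j x)) (transpose-inverse i j)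

transpose-injective : ∀ {k} (i j : Fin k) → Injective _≡_ _≡_ (transpose i j)
transpose-injective i j {x} {y} eq =
  trans (sym (transpose-involutive i j x)) (trans (cong (transpose i j) eq) (transpose-involutive i j y))

transpose-conjugate : ∀ {k} {l m′ m : Fin k} → l ≢ m′ → l ≢ m → m′ ≢ m →
  ∀ x → transpose l m x ≡ transpose m′ m (transpose l m′ (transpose m′ m x))
transpose-conjugate {l = l} {m′} {m} l≢m′ l≢m m′≢m x = cases (x Fin.≟ m) (x Fin.≟ l) (x Fin.≟ m′)
  where
  cases : Dec (x ≡ m) → Dec (x ≡ l) → Dec (x ≡ m′) → transpose l m x ≡ transpose m′ m (transpose l m′ (transpose m′ m x))
  cases (yes refl) _ _ rewrite transpose-matchʳ m′ x | transpose-matchʳ l m′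
                             | transpose-other {i = m′} {x} l≢m′ l≢m | transpose-matchʳ l x = refl
  cases (no _) (yes refl) _ rewrite transpose-other {i = m′} {m} l≢m′ l≢m | transpose-matchˡ x m′
                                  | transpose-matchˡ m′ m | transpose-matchˡ x m = refl
  cases (no x≢m) (no x≢l) (yes refl) rewrite transpose-matchˡ x m | transpose-other {i = l} {x} (l≢m ∘ sym) (x≢m ∘ sym)
                                           | transpose-matchʳ x m | transpose-other {i = l} {m} x≢l x≢m = refl
  cases (no x≢m) (no x≢l) (no x≢m′) rewrite transpose-other x≢m′ x≢m | transpose-other x≢l x≢m′
                                          | transpose-other x≢m′ x≢m | transpose-other x≢l x≢m = refl

injective⇒surjective : ∀ {k} (σ : Fin k → Fin k) → Injective _≡_ _≡_ σ → ∀ y → Σ (Fin k) λ x → σ x ≡ y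
injective⇒surjective {suc k} σ σ-inj y with FinP.any? (λ x → σ x Fin.≟ y)
... | yes hit = hit
... | no miss with FinP.pigeonhole (ℕP.n<1+n k) (λ x → Fin.punchOut {i = y} {j = σ x} (λ y≡σx → miss (x , sym y≡σx)))
...   | i , j , i<j , eq = ⊥-elim (ℕP.<⇒≢ i<j (cong toℕ (σ-inj (FinP.punchOut-injective {i = y} _ _ eq))))

inversionᵇ : ∀ {k} → (Fin k → Fin k) → Fin k → Fin k → Bool
inversionᵇ σ i j = ⌊ i Fin.<? j ⌋ ∧ ⌊ σ j Fin.<? σ i ⌋

inversions≡∑∑ : ∀ {k} (σ : Fin k → Fin k) → inversions σ ≡ sum (λ i → sum (λ j → indicator (inversionᵇ σ i j)))
inversions≡∑∑ {k} σ = trans (cong sumℕ (List.map-cong (λ i → countᵇ-allFin (inversionᵇ σ i)) (allFin k))) (sumℕ-allFin {k} _)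

∑∑-distrib-+ : ∀ {k} (f g : Fin k → Fin k → ℕ) →
  sum (λ i → sum (λ j → f i j + g i j)) ≡ sum (λ i → sum (f i)) + sum (λ i → sum (g i))
∑∑-distrib-+ {k} f g = trans (ℕΣ.sum-cong-≗ (λ i → ℕΣ.∑-distrib-+ (f i) (g i))) (ℕΣ.∑-distrib-+ {k} _ _)

sgn-cong : ∀ {k} {σ τ : Fin k → Fin k} → σ ≗ τ → sgn σ ≡ sgn τ
sgn-cong {σ = σ} {τ} σ≗τ = cong signOfℕ (begin
  inversions σ                                          ≡⟨ inversions≡∑∑ σ ⟩
  sum (λ i → sum (λ j → indicator (inversionᵇ σ i j)))
    ≡⟨ ℕΣ.sum-cong-≗ (λ i → ℕΣ.sum-cong-≗ λ j →
         cong (λ b → indicator (⌊ i Fin.<? j ⌋ ∧ b)) (cong₂ (λ a b → ⌊ a Fin.<? b ⌋) (σ≗τ j) (σ≗τ i))) ⟩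
  sum (λ i → sum (λ j → indicator (inversionᵇ τ i j))) ≡⟨ inversions≡∑∑ τ ⟨
  inversions τ ∎)
  where open ≡.≡-Reasoning

signOfℕ-flip : ∀ m n b → m + indicator b ≡ n + indicator (not b) → signOfℕ m ≡ - signOfℕ n
signOfℕ-flip m n true  eq =
  trans (sym (ℤP.neg-involutive _)) (cong (-_ ∘ signOfℕ) (trans (sym (ℕP.+-comm m 1)) (trans eq (ℕP.+-identityʳ n))))
signOfℕ-flip m n false eq = cong signOfℕ (trans (sym (ℕP.+-identityʳ m)) (trans eq (ℕP.+-comm n 1)))

count-ordered-preimages : ∀ {k} (σ : Fin k → Fin k) → Injective _≡_ _≡_ σ → ∀ {a c i₀ j₀} → σ i₀ ≡ a → σ j₀ ≡ c →
  sum (λ i → sum (λ j → indicator (⌊ σ i Fin.≟ a ⌋ ∧ ⌊ σ j Fin.≟ c ⌋ ∧ ⌊ i Fin.<? j ⌋))) ≡ indicator ⌊ i₀ Fin.<? j₀ ⌋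
count-ordered-preimages {k} σ σ-inj {a} {c} {i₀} {j₀} σi₀≡a σj₀≡c =
  trans (sum-point _ i₀ other-rows) (trans (sum-point _ j₀ other-columns) pair)
  where
  ≢-preimage : ∀ {x y i} → σ i ≡ y → x ≢ i → ⌊ σ x Fin.≟ y ⌋ ≡ false
  ≢-preimage {x} {y} σi≡y x≢i = isYes-false (σ x Fin.≟ y) (x≢i ∘ σ-inj ∘ flip trans (sym σi≡y))
  other-rows : ∀ i → i ≢ i₀ → sum (λ j → indicator (⌊ σ i Fin.≟ a ⌋ ∧ ⌊ σ j Fin.≟ c ⌋ ∧ ⌊ i Fin.<? j ⌋)) ≡ 0
  other-rows i i≢i₀ = trans
    (ℕΣ.sum-cong-≗ {k} (λ j → cong (λ b → indicator (b ∧ ⌊ σ j Fin.≟ c ⌋ ∧ ⌊ i Fin.<? j ⌋)) (≢-preimage σi₀≡a i≢i₀)))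
    (ℕΣ.sum-replicate-zero k)
  other-columns : ∀ j → j ≢ j₀ → indicator (⌊ σ i₀ Fin.≟ a ⌋ ∧ ⌊ σ j Fin.≟ c ⌋ ∧ ⌊ i₀ Fin.<? j ⌋) ≡ 0
  other-columns j j≢j₀ rewrite ≢-preimage σj₀≡c j≢j₀ = cong indicator (BoolP.∧-zeroʳ _)
  pair : indicator (⌊ σ i₀ Fin.≟ a ⌋ ∧ ⌊ σ j₀ Fin.≟ c ⌋ ∧ ⌊ i₀ Fin.<? j₀ ⌋) ≡ indicator ⌊ i₀ Fin.<? j₀ ⌋
  pair rewrite isYes-true (σ i₀ Fin.≟ a) σi₀≡a | isYes-true (σ j₀ Fin.≟ c) σj₀≡c = refl

module AdjacentTransposition {p} {k k′ : Fin p} (k′≡1+k : toℕ k′ ≡ suc (toℕ k)) where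

  private
    s : Fin p → Fin p
    s = transpose k k′

  k<k′ : k < k′
  k<k′ = subst (toℕ k ℕ.<_) (sym k′≡1+k) (ℕP.n<1+n _)

  k≢k′ : k ≢ k′
  k≢k′ refl = ℕP.<-irrefl refl k<k′

  private
    data View : Fin p → Fin p → Set where
      at-k  : View k k′
      at-k′ : View k′ k
      away  : ∀ {x} → x ≢ k → x ≢ k′ → View x x

    view : ∀ x → View x (s x)
    view x = cases (x Fin.≟ k) (x Fin.≟ k′)
      where
      cases : Dec (x ≡ k) → Dec (x ≡ k′) → View x (s x)
      cases (yes refl) _          = subst (View x) (sym (transpose-matchˡ x k′)) at-k
      cases (no _)     (yes refl) = subst (View x) (sym (transpose-matchʳ k x)) at-k′
      cases (no x≢k)   (no x≢k′)  = subst (View x) (sym (transpose-other x≢k x≢k′)) (away x≢k x≢k′)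

  s-mono : ∀ {w u} → w < u → ¬ (w ≡ k × u ≡ k′) → s w < s u
  s-mono {w} {u} = mono (view w) (view u)
    where
    mono : ∀ {w w′ u u′} → View w w′ → View u u′ → w < u → ¬ (w ≡ k × u ≡ k′) → w′ < u′
    mono at-k  at-k  k<k _ = ⊥-elim (ℕP.<-irrefl refl k<k)
    mono at-k  at-k′ _   ¬kk′ = ⊥-elim (¬kk′ (refl , refl))
    mono at-k  (away u≢k u≢k′) k<u _ =
      ℕP.≤∧≢⇒< (subst (ℕ._≤ _) (sym k′≡1+k) k<u) (u≢k′ ∘ FinP.toℕ-injective ∘ sym)
    mono at-k′ at-k  _ _ = k<k′
    mono at-k′ at-k′ k′<k′ _ = ⊥-elim (ℕP.<-irrefl refl k′<k′)
    mono at-k′ (away _ _) k′<u _ = ℕP.<-trans k<k′ k′<u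
    mono (away _ _) at-k w<k _ = ℕP.<-trans w<k k<k′
    mono (away w≢k _) at-k′ w<k′ _ =
      ℕP.≤∧≢⇒< (ℕP.≤-pred (subst (toℕ _ ℕ.<_) k′≡1+k w<k′)) (w≢k ∘ FinP.toℕ-injective)
    mono (away _ _) (away _ _) w<u _ = w<u

  s-<ᵇ : ∀ {u w} → ¬ (u ≡ k × w ≡ k′) → ¬ (u ≡ k′ × w ≡ k) → ⌊ s w Fin.<? s u ⌋ ≡ ⌊ w Fin.<? u ⌋
  s-<ᵇ {u} {w} ¬kk′ ¬k′k =
    isYes-⇔ (s w Fin.<? s u) (w Fin.<? u) reflect (λ w<u → s-mono w<u λ (w≡k , u≡k′) → ¬k′k (u≡k′ , w≡k))
    where
    s≡⇒ : ∀ {x y} → s x ≡ y → x ≡ s y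
    s≡⇒ {x} refl = sym (transpose-involutive k k′ x)
    reflect : s w < s u → w < u
    reflect sw<su = subst₂ _<_ (transpose-involutive k k′ w) (transpose-involutive k k′ u)
      (s-mono sw<su λ (sw≡k , su≡k′) →
        ¬kk′ (trans (s≡⇒ su≡k′) (transpose-matchʳ k k′) , trans (s≡⇒ sw≡k) (transpose-matchˡ k k′)))

  private
    pair-indicator≡0 : ∀ {x y a c : Fin p} b → ¬ (x ≡ a × y ≡ c) → indicator (⌊ x Fin.≟ a ⌋ ∧ ⌊ y Fin.≟ c ⌋ ∧ b) ≡ 0
    pair-indicator≡0 {x} {y} {a} {c} b ¬xy with x Fin.≟ a | y Fin.≟ c
    ... | yes x≡a | yes y≡c = ⊥-elim (¬xy (x≡a , y≡c))
    ... | yes _   | no _    = refl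
    ... | no _    | _       = refl

  -- With u = σ i, w = σ j and b = [i < j]: only the pair of values {k, k′} changes its inversion status.
  inversion-step : ∀ u w b →
    indicator (b ∧ ⌊ s w Fin.<? s u ⌋) + indicator (⌊ u Fin.≟ k′ ⌋ ∧ ⌊ w Fin.≟ k ⌋ ∧ b) ≡
    indicator (b ∧ ⌊ w Fin.<? u ⌋) + indicator (⌊ u Fin.≟ k ⌋ ∧ ⌊ w Fin.≟ k′ ⌋ ∧ b)
  inversion-step u w b with u Fin.≟ k ×-dec w Fin.≟ k′ | u Fin.≟ k′ ×-dec w Fin.≟ k
  ... | yes (refl , refl) | _
    rewrite transpose-matchˡ k k′ | transpose-matchʳ k k′ | isYes-true (k Fin.<? k′) k<k′
          | isYes-false (k′ Fin.<? k) (ℕP.<-asym k<k′) | isYes-false (k Fin.≟ k′) k≢k′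
          | isYes-true (k Fin.≟ k) refl | isYes-true (k′ Fin.≟ k′) refl
          | BoolP.∧-identityʳ b | BoolP.∧-zeroʳ b = ℕP.+-comm (indicator b) 0
  ... | no _ | yes (refl , refl)
    rewrite transpose-matchˡ k k′ | transpose-matchʳ k k′ | isYes-true (k Fin.<? k′) k<k′
          | isYes-false (k′ Fin.<? k) (ℕP.<-asym k<k′) | isYes-false (k′ Fin.≟ k) (k≢k′ ∘ sym)
          | isYes-true (k Fin.≟ k) refl | isYes-true (k′ Fin.≟ k′) refl
          | BoolP.∧-identityʳ b | BoolP.∧-zeroʳ b = ℕP.+-comm 0 (indicator b)
  ... | no ¬kk′ | no ¬k′k
    rewrite s-<ᵇ ¬kk′ ¬k′k | pair-indicator≡0 b ¬k′k | pair-indicator≡0 b ¬kk′ = refl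

  sgn-transpose-adjacent : ∀ (σ : Fin p → Fin p) → Injective _≡_ _≡_ σ → sgn (s ∘ σ) ≡ - sgn σ
  sgn-transpose-adjacent σ σ-inj = signOfℕ-flip (inversions (s ∘ σ)) (inversions σ) ⌊ j₀ Fin.<? i₀ ⌋ (begin
    inversions (s ∘ σ) + indicator ⌊ j₀ Fin.<? i₀ ⌋
      ≡⟨ cong₂ _+_ (inversions≡∑∑ (s ∘ σ)) (sym (count-ordered-preimages σ σ-inj σj₀≡k′ σi₀≡k)) ⟩
    sum (λ i → sum (λ j → indicator (inversionᵇ (s ∘ σ) i j))) + sum (λ i → sum (λ j → pair k′ k i j))
      ≡⟨ ∑∑-distrib-+ (λ i j → indicator (inversionᵇ (s ∘ σ) i j)) (pair k′ k) ⟨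
    sum (λ i → sum (λ j → indicator (inversionᵇ (s ∘ σ) i j) + pair k′ k i j))
      ≡⟨ ℕΣ.sum-cong-≗ (λ i → ℕΣ.sum-cong-≗ λ j → inversion-step (σ i) (σ j) ⌊ i Fin.<? j ⌋) ⟩
    sum (λ i → sum (λ j → indicator (inversionᵇ σ i j) + pair k k′ i j))
      ≡⟨ ∑∑-distrib-+ (λ i j → indicator (inversionᵇ σ i j)) (pair k k′) ⟩
    sum (λ i → sum (λ j → indicator (inversionᵇ σ i j))) + sum (λ i → sum (λ j → pair k k′ i j))
      ≡⟨ cong₂ _+_ (sym (inversions≡∑∑ σ)) (count-ordered-preimages σ σ-inj σi₀≡k σj₀≡k′) ⟩
    inversions σ + indicator ⌊ i₀ Fin.<? j₀ ⌋
      ≡⟨ cong (λ b → inversions σ + indicator b) <ᵇ-flip ⟩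
    inversions σ + indicator (not ⌊ j₀ Fin.<? i₀ ⌋) ∎)
    where
    open ≡.≡-Reasoning
    pair : Fin p → Fin p → Fin p → Fin p → ℕ
    pair a c i j = indicator (⌊ σ i Fin.≟ a ⌋ ∧ ⌊ σ j Fin.≟ c ⌋ ∧ ⌊ i Fin.<? j ⌋)
    i₀ = proj₁ (injective⇒surjective σ σ-inj k)
    j₀ = proj₁ (injective⇒surjective σ σ-inj k′)
    σi₀≡k  = proj₂ (injective⇒surjective σ σ-inj k)
    σj₀≡k′ = proj₂ (injective⇒surjective σ σ-inj k′)
    <ᵇ-flip : ⌊ i₀ Fin.<? j₀ ⌋ ≡ not ⌊ j₀ Fin.<? i₀ ⌋
    <ᵇ-flip with i₀ Fin.<? j₀ | j₀ Fin.<? i₀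
    ... | yes i₀<j₀ | yes j₀<i₀ = ⊥-elim (ℕP.<-asym i₀<j₀ j₀<i₀)
    ... | yes _     | no _      = refl
    ... | no _      | yes _     = refl
    ... | no i₀≮j₀  | no j₀≮i₀  = ⊥-elim (k≢k′ (trans (sym σi₀≡k) (trans (cong σ i₀≡j₀) σj₀≡k′)))
      where i₀≡j₀ = FinP.toℕ-injective (ℕP.≤-antisym (ℕP.≮⇒≥ j₀≮i₀) (ℕP.≮⇒≥ i₀≮j₀))

transpose∘-injective : ∀ {p} (l m : Fin p) {σ : Fin p → Fin p} → Injective _≡_ _≡_ σ → Injective _≡_ _≡_ (transpose l m ∘ σ)
transpose∘-injective l m σ-inj = Composition.injective _≡_ _≡_ _≡_ σ-inj (transpose-injective l m)

private
  distance : ∀ {a b} → a ℕ.< b → b ≡ suc (b ℕ.∸ suc a + a)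
  distance {a} a<b = sym (trans (cong suc (ℕP.+-comm _ a)) (ℕP.m+[n∸m]≡n a<b))

  sgn-transpose-at-distance : ∀ {p} d {l m : Fin p} → toℕ m ≡ suc (d + toℕ l) →
    ∀ σ → Injective _≡_ _≡_ σ → sgn (transpose l m ∘ σ) ≡ - sgn σ
  sgn-transpose-at-distance zero    m≡1+l = AdjacentTransposition.sgn-transpose-adjacent m≡1+l
  sgn-transpose-at-distance {p} (suc d) {l} {m} m≡2+d+l σ σ-inj = begin
    sgn (transpose l m ∘ σ)                                       ≡⟨ sgn-cong (transpose-conjugate l≢m′ l≢m m′≢m ∘ σ) ⟩
    sgn (transpose m′ m ∘ (transpose l m′ ∘ (transpose m′ m ∘ σ))) ≡⟨ sgn-transpose-adjacent _ (transpose∘-injective l m′ τσ-inj) ⟩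
    - sgn (transpose l m′ ∘ (transpose m′ m ∘ σ))                 ≡⟨ cong -_ (sgn-transpose-at-distance d m′≡1+d+l _ τσ-inj) ⟩
    - - sgn (transpose m′ m ∘ σ)                                  ≡⟨ ℤP.neg-involutive _ ⟩
    sgn (transpose m′ m ∘ σ)                                      ≡⟨ sgn-transpose-adjacent σ σ-inj ⟩
    - sgn σ ∎
    where
    open ≡.≡-Reasoning
    m′<p : suc (d + toℕ l) ℕ.< p
    m′<p = ℕP.<-trans (ℕP.n<1+n _) (subst (ℕ._< p) m≡2+d+l (FinP.toℕ<n m))
    m′ : Fin p
    m′ = Fin.fromℕ< m′<p
    m′≡1+d+l : toℕ m′ ≡ suc (d + toℕ l)
    m′≡1+d+l = FinP.toℕ-fromℕ< m′<p
    m≡1+m′ : toℕ m ≡ suc (toℕ m′)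
    m≡1+m′ = trans m≡2+d+l (cong suc (sym m′≡1+d+l))
    open AdjacentTransposition m≡1+m′ using (sgn-transpose-adjacent) renaming (k≢k′ to m′≢m)
    τσ-inj : Injective _≡_ _≡_ (transpose m′ m ∘ σ)
    τσ-inj = transpose∘-injective m′ m σ-inj
    l<m′ : toℕ l ℕ.< toℕ m′
    l<m′ = subst (toℕ l ℕ.<_) (sym m′≡1+d+l) (ℕ.s≤s (ℕP.m≤n+m _ _))
    l≢m′ : l ≢ m′
    l≢m′ l≡m′ = ℕP.<-irrefl (cong toℕ l≡m′) l<m′
    l≢m : l ≢ m
    l≢m l≡m = ℕP.<-irrefl (cong toℕ l≡m) (subst (toℕ l ℕ.<_) (sym m≡1+m′) (ℕP.<-trans l<m′ (ℕP.n<1+n _)))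

sgn-transpose : ∀ {p} {l m : Fin p} → l ≢ m → ∀ σ → Injective _≡_ _≡_ σ → sgn (transpose l m ∘ σ) ≡ - sgn σ
sgn-transpose {l = l} {m} l≢m σ σ-inj with ℕP.<-cmp (toℕ l) (toℕ m)
... | tri< l<m _ _ = sgn-transpose-at-distance (toℕ m ℕ.∸ suc (toℕ l)) (distance l<m) σ σ-inj
... | tri≈ _ l≡m _ = ⊥-elim (l≢m (FinP.toℕ-injective l≡m))
... | tri> _ _ m<l = trans (sgn-cong (λ i → transpose-comm l m (σ i)))
                           (sgn-transpose-at-distance (toℕ l ℕ.∸ suc (toℕ m)) (distance m<l) σ σ-inj)

-- Row contents

module _ {n : ℕ} {sh : Partition} where

  boxEntry : Filling n sh → Fin (cols sh) → ℕ → Maybe (Fin n)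
  boxEntry G c r with r ℕ.<? ζ sh c
  ... | yes r<ζ = just (entry G c (fromℕ< r<ζ))
  ... | no _    = nothing

  holds : Maybe (Fin n) → Fin n → Bool
  holds nothing  v = false
  holds (just x) v = ⌊ x Fin.≟ v ⌋

  boxEntry-toℕ : ∀ (G : Filling n sh) c (x : Fin (ζ sh c)) → boxEntry G c (toℕ x) ≡ just (entry G c x)
  boxEntry-toℕ G c x with toℕ x ℕ.<? ζ sh c
  ... | yes x<ζ = cong (just ∘ entry G c) (FinP.fromℕ<-toℕ x x<ζ)
  ... | no x≮ζ  = ⊥-elim (x≮ζ (FinP.toℕ<n x))

  boxEntry-cong : ∀ (G H : Filling n sh) c r → (∀ x → toℕ x ≡ r → entry G c x ≡ entry H c x) →
    boxEntry G c r ≡ boxEntry H c r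
  boxEntry-cong G H c r G≡H with r ℕ.<? ζ sh c
  ... | yes r<ζ = cong just (G≡H _ (FinP.toℕ-fromℕ< r<ζ))
  ... | no _    = refl

  private
    -- rowCount's column test is local to its definition; unifying with the unfolded rowCount names it.
    columnTest : Filling n sh → ℕ → Fin n → Fin (cols sh) → Bool
    columnTest G r v = testOf (refl {x = rowCount G r v})
      where
      testOf : ∀ {p : Fin (cols sh) → Bool} {m} → countᵇ p (allFin (cols sh)) ≡ m → Fin (cols sh) → Bool
      testOf {p} _ = p

    columnTest-holds : ∀ G r v c → columnTest G r v c ≡ holds (boxEntry G c r) v
    columnTest-holds G r v c with r ℕ.<? ζ sh c
    ... | yes _ = refl
    ... | no _  = refl

  rowCount≡sum : ∀ (G : Filling n sh) r v → rowCount G r v ≡ sum (λ c → indicator (holds (boxEntry G c r) v))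
  rowCount≡sum G r v = trans (countᵇ-allFin (columnTest G r v)) (ℕΣ.sum-cong-≗ (cong indicator ∘ columnTest-holds G r v))

  rowCount-permuteColumns : ∀ (G H : Filling n sh) r (σ : Permutation′ (cols sh)) →
    (∀ c → boxEntry H c r ≡ boxEntry G (σ ⟨$⟩ʳ c) r) → ∀ v → rowCount H r v ≡ rowCount G r v
  rowCount-permuteColumns G H r σ H≡Gσ v = begin
    rowCount H r v                                             ≡⟨ rowCount≡sum H r v ⟩
    sum (λ c → indicator (holds (boxEntry H c r) v))           ≡⟨ ℕΣ.sum-cong-≗ (λ c → cong (λ e → indicator (holds e v)) (H≡Gσ c)) ⟩
    sum (λ c → indicator (holds (boxEntry G (σ ⟨$⟩ʳ c) r) v))  ≡⟨ ℕΣ.sum-permute _ σ ⟨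
    sum (λ c → indicator (holds (boxEntry G c r) v))           ≡⟨ rowCount≡sum G r v ⟨
    rowCount G r v ∎
    where open ≡.≡-Reasoning

  SameRowCounts : Filling n sh → Filling n sh → Set
  SameRowCounts G H = ∀ r v → rowCount G r v ≡ rowCount H r v

  rowCount-cong : ∀ {G H : Filling n sh} → (∀ c x → entry G c x ≡ entry H c x) → SameRowCounts G H
  rowCount-cong {G} {H} G≡H r = rowCount-permuteColumns H G r Perm.id (λ c → boxEntry-cong G H c r (λ x _ → G≡H c x))

  record BoxesSwapped (H G : Filling n sh) (a b : Fin (cols sh)) (ra : Fin (ζ sh a)) (rb : Fin (ζ sh b)) : Set where
    field
      at₁       : entry H a ra ≡ entry G b rb
      at₂       : entry H b rb ≡ entry G a ra
      column₁   : ∀ x → x ≢ ra → entry H a x ≡ entry G a x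
      column₂   : ∀ x → x ≢ rb → entry H b x ≡ entry G b x
      elsewhere : ∀ c x → c ≢ a → c ≢ b → entry H c x ≡ entry G c x

  module _ {H G : Filling n sh} {a b ra rb} (ra≡rb : toℕ ra ≡ toℕ rb) (swapped : BoxesSwapped H G a b ra rb) where
    open BoxesSwapped swapped

    boxEntry-swappedRow : ∀ c → boxEntry H c (toℕ ra) ≡ boxEntry G (transpose a b c) (toℕ ra)
    boxEntry-swappedRow c = cases (c Fin.≟ a) (c Fin.≟ b)
      where
      open ≡.≡-Reasoning
      cases : Dec (c ≡ a) → Dec (c ≡ b) → boxEntry H c (toℕ ra) ≡ boxEntry G (transpose a b c) (toℕ ra)
      cases (yes refl) _ = begin
        boxEntry H c (toℕ ra)                  ≡⟨ boxEntry-toℕ H c ra ⟩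
        just (entry H c ra)                    ≡⟨ cong just at₁ ⟩
        just (entry G b rb)                    ≡⟨ boxEntry-toℕ G b rb ⟨
        boxEntry G b (toℕ rb)                  ≡⟨ cong₂ (λ c′ r′ → boxEntry G c′ r′) (transpose-matchˡ c b) ra≡rb ⟨
        boxEntry G (transpose c b c) (toℕ ra) ∎
      cases (no _) (yes refl) = begin
        boxEntry H c (toℕ ra)                  ≡⟨ cong (boxEntry H c) ra≡rb ⟩
        boxEntry H c (toℕ rb)                  ≡⟨ boxEntry-toℕ H c rb ⟩
        just (entry H c rb)                    ≡⟨ cong just at₂ ⟩
        just (entry G a ra)                    ≡⟨ boxEntry-toℕ G a ra ⟨
        boxEntry G a (toℕ ra)                  ≡⟨ cong (λ c′ → boxEntry G c′ (toℕ ra)) (transpose-matchʳ a c) ⟨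
        boxEntry G (transpose a c c) (toℕ ra) ∎
      cases (no c≢a) (no c≢b) = begin
        boxEntry H c (toℕ ra)                  ≡⟨ boxEntry-cong H G c (toℕ ra) (λ x _ → elsewhere c x c≢a c≢b) ⟩
        boxEntry G c (toℕ ra)                  ≡⟨ cong (λ c′ → boxEntry G c′ (toℕ ra)) (transpose-other c≢a c≢b) ⟨
        boxEntry G (transpose a b c) (toℕ ra) ∎

    boxEntry-otherRow : ∀ {r} → r ≢ toℕ ra → ∀ c → boxEntry H c r ≡ boxEntry G c r
    boxEntry-otherRow {r} r≢ra c with c Fin.≟ a | c Fin.≟ b
    ... | yes refl | _        = boxEntry-cong H G c r (λ x x≡r → column₁ x λ { refl → r≢ra (sym x≡r) })
    ... | no _     | yes refl = boxEntry-cong H G c r (λ x x≡r → column₂ x λ { refl → r≢ra (trans (sym x≡r) (sym ra≡rb)) })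
    ... | no c≢a   | no c≢b   = boxEntry-cong H G c r (λ x _ → elsewhere c x c≢a c≢b)

    rowCount-boxesSwapped : SameRowCounts H G
    rowCount-boxesSwapped r with r ℕ.≟ toℕ ra
    ... | yes refl = rowCount-permuteColumns G H r (Perm.transpose a b) boxEntry-swappedRow
    ... | no r≢ra  = rowCount-permuteColumns G H r Perm.id (boxEntry-otherRow r≢ra)

  sameRowContentᵇ-cong : ∀ {G H : Filling n sh} → SameRowCounts G H → ∀ T → sameRowContentᵇ G T ≡ sameRowContentᵇ H T
  sameRowContentᵇ-cong {G} {H} G∼H T =
    allᵇ-cong (allFin (size sh)) λ r → allᵇ-cong (allFin n) λ v → cong (λ m → ⌊ m ℕ.≟ rowCount T (toℕ r) v ⌋) (G∼H (toℕ r) v)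
    where
    allᵇ-cong : ∀ {A : Set} {p q : A → Bool} xs → (∀ x → p x ≡ q x) → allᵇ p xs ≡ allᵇ q xs
    allᵇ-cong []       p≡q = refl
    allᵇ-cong (x ∷ xs) p≡q = cong₂ _∧_ (p≡q x) (allᵇ-cong xs p≡q)

module _ {n sh} (G : Filling n sh) {a b : Fin (cols sh)} (ra : Fin (ζ sh a)) (rb : Fin (ζ sh b)) where

  exchange-at₁ : entry (exchange G a b ra rb) a ra ≡ entry G b rb
  exchange-at₁ with a Fin.≟ a
  ... | no a≢a = ⊥-elim (a≢a refl)
  ... | yes refl with ra Fin.≟ ra
  ...   | yes _   = refl
  ...   | no ra≢ra = ⊥-elim (ra≢ra refl)

  exchange-column₁ : ∀ x → x ≢ ra → entry (exchange G a b ra rb) a x ≡ entry G a x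
  exchange-column₁ x x≢ra with a Fin.≟ a
  ... | no a≢a = ⊥-elim (a≢a refl)
  ... | yes refl with x Fin.≟ ra
  ...   | yes x≡ra = ⊥-elim (x≢ra x≡ra)
  ...   | no _     = refl

  module _ (a≢b : a ≢ b) where

    exchange-at₂ : entry (exchange G a b ra rb) b rb ≡ entry G a ra
    exchange-at₂ with b Fin.≟ a
    ... | yes b≡a = ⊥-elim (a≢b (sym b≡a))
    ... | no _ with b Fin.≟ b
    ...   | no b≢b = ⊥-elim (b≢b refl)
    ...   | yes refl with rb Fin.≟ rb
    ...     | yes _    = refl
    ...     | no rb≢rb = ⊥-elim (rb≢rb refl)

    exchange-column₂ : ∀ x → x ≢ rb → entry (exchange G a b ra rb) b x ≡ entry G b x
    exchange-column₂ x x≢rb with b Fin.≟ a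
    ... | yes b≡a = ⊥-elim (a≢b (sym b≡a))
    ... | no _ with b Fin.≟ b
    ...   | no b≢b = ⊥-elim (b≢b refl)
    ...   | yes refl with x Fin.≟ rb
    ...     | yes x≡rb = ⊥-elim (x≢rb x≡rb)
    ...     | no _     = refl

  exchange-elsewhere : ∀ c x → c ≢ a → c ≢ b → entry (exchange G a b ra rb) c x ≡ entry G c x
  exchange-elsewhere c x c≢a c≢b with c Fin.≟ a
  ... | yes c≡a = ⊥-elim (c≢a c≡a)
  ... | no _ with c Fin.≟ b
  ...   | yes c≡b = ⊥-elim (c≢b c≡b)
  ...   | no _    = refl

-- Multipermutations

module ℤΠ = CommutativeMonoidSum ℤP.*-1-commutativeMonoid

prodℤ-allFin : ∀ {k} (f : Fin k → ℤ) → prodℤ (map f (allFin k)) ≡ ℤΠ.sum f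
prodℤ-allFin f = trans (cong prodℤ (List.map-tabulate (λ i → i) f)) (prodℤ-tabulate f)
  where
  prodℤ-tabulate : ∀ {k} (f : Fin k → ℤ) → prodℤ (tabulate f) ≡ ℤΠ.sum f
  prodℤ-tabulate {zero}  f = refl
  prodℤ-tabulate {suc k} f = cong (f Fin.zero *_) (prodℤ-tabulate (f ∘ Fin.suc))

product-negate-one : ∀ {k} (f g : Fin k → ℤ) a → (∀ i → i ≢ a → g i ≡ f i) → g a ≡ - f a → ℤΠ.sum g ≡ - ℤΠ.sum f
product-negate-one {suc k} f g a g≡f ga≡-fa = begin
  ℤΠ.sum g                          ≡⟨ ℤΠ.sum-remove g ⟩
  g a * ℤΠ.sum (removeAt g a)       ≡⟨ cong₂ _*_ ga≡-fa (ℤΠ.sum-cong-≗ (λ i → g≡f _ (FinP.punchInᵢ≢i a i))) ⟩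
  - f a * ℤΠ.sum (removeAt f a)     ≡⟨ ℤP.neg-distribˡ-* (f a) _ ⟨
  - (f a * ℤΠ.sum (removeAt f a))   ≡⟨ cong -_ (ℤΠ.sum-remove f) ⟨
  - ℤΠ.sum f ∎
  where open ≡.≡-Reasoning

module MultiPermutations (sh : Partition) where

  _≗ᵐ_ : MultiPerm sh → MultiPerm sh → Set
  π ≗ᵐ π′ = ∀ c r → π c r ≡ π′ c r

  sgnMulti≡∏ : ∀ (π : MultiPerm sh) → sgnMulti {sh} π ≡ ℤΠ.sum (λ c → sgn (π c))
  sgnMulti≡∏ π = prodℤ-allFin (λ c → sgn (π c))

  sgnMulti-cong : ∀ {π π′ : MultiPerm sh} → π ≗ᵐ π′ → sgnMulti {sh} π ≡ sgnMulti {sh} π′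
  sgnMulti-cong {π} {π′} π≗π′ = cong prodℤ (List.map-cong (λ c → sgn-cong (π≗π′ c)) (allFin (cols sh)))

  postcomposeColumn : (c : Fin (cols sh)) → (Fin (ζ sh c) → Fin (ζ sh c)) → MultiPerm sh → MultiPerm sh
  postcomposeColumn c τ π c′ with c′ Fin.≟ c
  ... | yes refl = τ ∘ π c′
  ... | no _     = π c′

  module _ (c : Fin (cols sh)) (τ : Fin (ζ sh c) → Fin (ζ sh c)) (π : MultiPerm sh) where

    postcomposeColumn-here : ∀ r → postcomposeColumn c τ π c r ≡ τ (π c r)
    postcomposeColumn-here r with c Fin.≟ c
    ... | yes refl = refl
    ... | no c≢c   = ⊥-elim (c≢c refl)

    postcomposeColumn-elsewhere : ∀ {c′} → c′ ≢ c → ∀ r → postcomposeColumn c τ π c′ r ≡ π c′ r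
    postcomposeColumn-elsewhere {c′} c′≢c r with c′ Fin.≟ c
    ... | yes c′≡c = ⊥-elim (c′≢c c′≡c)
    ... | no _     = refl

    postcomposeColumn-isMultiPerm : Injective _≡_ _≡_ τ → IsMultiPerm {sh} π → IsMultiPerm {sh} (postcomposeColumn c τ π)
    postcomposeColumn-isMultiPerm τ-inj π-inj c′ with c′ Fin.≟ c
    ... | yes refl = λ eq → π-inj c′ (τ-inj eq)
    ... | no _     = π-inj c′

  postcomposeColumn-cong : ∀ c {τ τ′ : Fin (ζ sh c) → Fin (ζ sh c)} {π π′} → τ ≗ τ′ → π ≗ᵐ π′ →
    postcomposeColumn c τ π ≗ᵐ postcomposeColumn c τ′ π′
  postcomposeColumn-cong c {τ} {τ′} {π} {π′} τ≗τ′ π≗π′ c′ r with c′ Fin.≟ c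
  ... | yes refl = trans (cong τ (π≗π′ c′ r)) (τ≗τ′ _)
  ... | no _     = π≗π′ c′ r

  sgnMulti-postcompose-transpose : ∀ {c : Fin (cols sh)} {l m} → l ≢ m → ∀ (π : MultiPerm sh) → Injective _≡_ _≡_ (π c) →
    sgnMulti {sh} (postcomposeColumn c (transpose l m) π) ≡ - sgnMulti {sh} π
  sgnMulti-postcompose-transpose {c} {l} {m} l≢m π πc-inj = begin
    sgnMulti {sh} (postcomposeColumn c (transpose l m) π)     ≡⟨ sgnMulti≡∏ _ ⟩
    ℤΠ.sum (λ c′ → sgn (postcomposeColumn c (transpose l m) π c′))
      ≡⟨ product-negate-one (λ c′ → sgn (π c′)) _ c (λ c′ c′≢c → sgn-cong (postcomposeColumn-elsewhere c _ π c′≢c))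
           (trans (sgn-cong (postcomposeColumn-here c _ π)) (sgn-transpose l≢m (π c) πc-inj)) ⟩
    - ℤΠ.sum (λ c′ → sgn (π c′))                               ≡⟨ cong -_ (sgnMulti≡∏ π) ⟨
    - sgnMulti {sh} π ∎
    where open ≡.≡-Reasoning

module PlückerRelation {n} {sh : Partition} (F S : Filling n sh)
  {j j′ : Fin (cols sh)} (j′≡1+j : toℕ j′ ≡ suc (toℕ j)) where

  open MultiPermutations sh

  private
    p = ζ sh j
    q = ζ sh j′
    t = top sh j′

  j≢j′ : j ≢ j′
  j≢j′ j≡j′ = ℕP.<-irrefl (cong toℕ j≡j′) (subst (toℕ j ℕ.<_) (sym j′≡1+j) (ℕP.n<1+n _))

  q≤p : q ℕ.≤ p
  q≤p = weakDec sh j j′ (subst (toℕ j ℕ.≤_) (sym j′≡1+j) (ℕP.n≤1+n _))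

  Fₗ : Fin p → Filling n sh
  Fₗ l = exchange F j j′ l t

  weight : Filling n sh → MultiPerm sh → ℤ
  weight G π = if sameRowContentᵇ (act G π) S then sgnMulti {sh} π else 0ℤ

  weight-cong : ∀ G {π π′ : MultiPerm sh} → π ≗ᵐ π′ → weight G π ≡ weight G π′
  weight-cong G {π} {π′} π≗π′
    rewrite sameRowContentᵇ-cong (rowCount-cong {G = act G π} {act G π′} (λ c x → cong (entry G c) (π≗π′ c x))) S
          | sgnMulti-cong π≗π′ = refl

  weight-sameRows : ∀ {G H π} → SameRowCounts (act H π) (act G π) → weight H π ≡ weight G π
  weight-sameRows {G} {H} {π} H∼G rewrite sameRowContentᵇ-cong H∼G S = refl

  weight-sameRows-flip : ∀ {G H π π′} → SameRowCounts (act H π′) (act G π) →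
    sgnMulti {sh} π′ ≡ - sgnMulti {sh} π → weight H π′ ≡ - weight G π
  weight-sameRows-flip {G} {H} {π} {π′} H∼G sgn-flip rewrite sameRowContentᵇ-cong H∼G S
    with sameRowContentᵇ (act G π) S
  ... | true  = sgn-flip
  ... | false = refl

  pivotRow : MultiPerm sh → Fin q
  pivotRow π with FinP.any? (λ r → π j′ r Fin.≟ t)
  ... | yes (r , _) = r
  ... | no _        = t  -- unreachable for multipermutations, see pivotRow-spec

  pivotRow-spec : ∀ {π} → IsMultiPerm {sh} π → π j′ (pivotRow π) ≡ t
  pivotRow-spec {π} π-inj with FinP.any? (λ r → π j′ r Fin.≟ t)
  ... | yes (_ , πr≡t) = πr≡t
  ... | no miss        = ⊥-elim (miss (injective⇒surjective (π j′) (π-inj j′) t))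

  pivotRowⱼ : MultiPerm sh → Fin p
  pivotRowⱼ π = Fin.inject≤ (pivotRow π) q≤p

  pivot : MultiPerm sh → Fin p
  pivot π = π j (pivotRowⱼ π)

  isMultiPerm-resp : ∀ {π π′} → π ≗ᵐ π′ → IsMultiPerm {sh} π → IsMultiPerm {sh} π′
  isMultiPerm-resp π≗π′ π-inj c eq = π-inj c (trans (π≗π′ c _) (trans eq (sym (π≗π′ c _))))

  pivotRow-cong : ∀ {π π′} → IsMultiPerm {sh} π → IsMultiPerm {sh} π′ → π j′ ≗ π′ j′ → pivotRow π ≡ pivotRow π′
  pivotRow-cong π-inj π′-inj πj′≗π′j′ =
    π-inj j′ (trans (pivotRow-spec π-inj) (sym (trans (πj′≗π′j′ _) (pivotRow-spec π′-inj))))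

  pivot-cong : ∀ {π π′} → IsMultiPerm {sh} π → π ≗ᵐ π′ → pivot π ≡ pivot π′
  pivot-cong {π} {π′} π-inj π≗π′ = trans (π≗π′ j _)
    (cong (λ r → π′ j (Fin.inject≤ r q≤p)) (pivotRow-cong π-inj (isMultiPerm-resp π≗π′ π-inj) (π≗π′ j′)))


  module _ {π : MultiPerm sh} (π-inj : IsMultiPerm {sh} π) where

    private
      r₀  = pivotRow π
      r₀ⱼ = pivotRowⱼ π
      m   = pivot π
      r₀ⱼ≡r₀ : toℕ r₀ⱼ ≡ toℕ r₀
      r₀ⱼ≡r₀ = FinP.toℕ-inject≤ r₀ q≤p
      off-pivot : ∀ x → x ≢ r₀ⱼ → π j x ≢ m
      off-pivot x x≢r₀ⱼ = x≢r₀ⱼ ∘ π-inj j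
      off-top : ∀ x → x ≢ r₀ → π j′ x ≢ t
      off-top x x≢r₀ πx≡t = x≢r₀ (π-inj j′ (trans πx≡t (sym (pivotRow-spec π-inj))))

    weight-pivot : weight (Fₗ m) π ≡ weight F π
    weight-pivot = weight-sameRows {G = F} {H = Fₗ m} (rowCount-boxesSwapped {H = act (Fₗ m) π} {G = act F π} r₀ⱼ≡r₀ record
      { at₁       = trans (exchange-at₁ F m t) (cong (entry F j′) (sym (pivotRow-spec π-inj)))
      ; at₂       = trans (cong (entry (Fₗ m) j′) (pivotRow-spec π-inj)) (exchange-at₂ F m t j≢j′)
      ; column₁   = λ x x≢r₀ⱼ → exchange-column₁ F m t (π j x) (off-pivot x x≢r₀ⱼ)
      ; column₂   = λ x x≢r₀ → exchange-column₂ F m t j≢j′ (π j′ x) (off-top x x≢r₀)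
      ; elsewhere = λ c x c≢j c≢j′ → exchange-elsewhere F m t c (π c x) c≢j c≢j′
      })

    weight-transpose : ∀ {l} → l ≢ m → weight (Fₗ m) (postcomposeColumn j (transpose l m) π) ≡ - weight (Fₗ l) π
    weight-transpose {l} l≢m = weight-sameRows-flip {G = Fₗ l} {H = Fₗ m}
      (rowCount-boxesSwapped {H = act (Fₗ m) π′} {G = act (Fₗ l) π} r₀ⱼ≡r₀ record
        { at₁       = begin
            entry (Fₗ m) j (π′ j r₀ⱼ)
              ≡⟨ cong (entry (Fₗ m) j) (trans (postcomposeColumn-here j _ π r₀ⱼ) (transpose-matchʳ l m)) ⟩
            entry (Fₗ m) j l                   ≡⟨ exchange-column₁ F m t l l≢m ⟩
            entry F j l                        ≡⟨ exchange-at₂ F l t j≢j′ ⟨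
            entry (Fₗ l) j′ t                  ≡⟨ cong (entry (Fₗ l) j′) (pivotRow-spec π-inj) ⟨
            entry (Fₗ l) j′ (π j′ r₀) ∎
        ; at₂       = begin
            entry (Fₗ m) j′ (π′ j′ r₀)
              ≡⟨ cong (entry (Fₗ m) j′) (trans (postcomposeColumn-elsewhere j _ π (j≢j′ ∘ sym) r₀) (pivotRow-spec π-inj)) ⟩
            entry (Fₗ m) j′ t                  ≡⟨ exchange-at₂ F m t j≢j′ ⟩
            entry F j m                        ≡⟨ exchange-column₁ F l t m (l≢m ∘ sym) ⟨
            entry (Fₗ l) j m ∎
        ; column₁   = λ x x≢r₀ⱼ →
            trans (cong (entry (Fₗ m) j) (postcomposeColumn-here j _ π x)) (column₁ (π j x) (off-pivot x x≢r₀ⱼ))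
        ; column₂   = λ x x≢r₀ → begin
            entry (Fₗ m) j′ (π′ j′ x)          ≡⟨ cong (entry (Fₗ m) j′) (postcomposeColumn-elsewhere j _ π (j≢j′ ∘ sym) x) ⟩
            entry (Fₗ m) j′ (π j′ x)           ≡⟨ exchange-column₂ F m t j≢j′ (π j′ x) (off-top x x≢r₀) ⟩
            entry F j′ (π j′ x)                ≡⟨ exchange-column₂ F l t j≢j′ (π j′ x) (off-top x x≢r₀) ⟨
            entry (Fₗ l) j′ (π j′ x) ∎
        ; elsewhere = λ c x c≢j c≢j′ → begin
            entry (Fₗ m) c (π′ c x)            ≡⟨ cong (entry (Fₗ m) c) (postcomposeColumn-elsewhere j _ π c≢j x) ⟩
            entry (Fₗ m) c (π c x)             ≡⟨ exchange-elsewhere F m t c (π c x) c≢j c≢j′ ⟩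
            entry F c (π c x)                  ≡⟨ exchange-elsewhere F l t c (π c x) c≢j c≢j′ ⟨
            entry (Fₗ l) c (π c x) ∎
        })
      (sgnMulti-postcompose-transpose l≢m π (π-inj j))
      where
      open ≡.≡-Reasoning
      π′ = postcomposeColumn j (transpose l m) π
      column₁ : ∀ y → y ≢ m → entry (Fₗ m) j (transpose l m y) ≡ entry (Fₗ l) j y
      column₁ y y≢m = cases (y Fin.≟ l)
        where
        cases : Dec (y ≡ l) → entry (Fₗ m) j (transpose l m y) ≡ entry (Fₗ l) j y
        cases (yes refl) = trans (cong (entry (Fₗ m) j) (transpose-matchˡ y m)) (trans (exchange-at₁ F m t) (sym (exchange-at₁ F y t)))
        cases (no y≢l)   = trans (cong (entry (Fₗ m) j) (transpose-other y≢l y≢m))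
                                 (trans (exchange-column₁ F m t y y≢m) (sym (exchange-column₁ F l t y y≢l)))

  pivot-postcompose : ∀ {π} l → IsMultiPerm {sh} π → pivot (postcomposeColumn j (transpose l (pivot π)) π) ≡ l
  pivot-postcompose {π} l π-inj = begin
    π′ j (Fin.inject≤ (pivotRow π′) q≤p)
      ≡⟨ cong (λ r → π′ j (Fin.inject≤ r q≤p)) (pivotRow-cong π′-inj π-inj (postcomposeColumn-elsewhere j _ π (j≢j′ ∘ sym))) ⟩
    π′ j (pivotRowⱼ π)                              ≡⟨ postcomposeColumn-here j _ π (pivotRowⱼ π) ⟩
    transpose l (pivot π) (pivot π)                 ≡⟨ transpose-matchʳ l (pivot π) ⟩
    l ∎
    where
    open ≡.≡-Reasoning
    π′ = postcomposeColumn j (transpose l (pivot π)) π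
    π′-inj = postcomposeColumn-isMultiPerm j _ π (transpose-injective l (pivot π)) π-inj

  Index : Setoid 0ℓ 0ℓ
  Index = ≡.setoid (Fin (suc p)) ×ₛ MultiPerm-setoid sh

  IsIndex : Fin (suc p) × MultiPerm sh → Set
  IsIndex (_ , π) = IsMultiPerm {sh} π

  term : Fin (suc p) × MultiPerm sh → ℤ
  term (Fin.zero  , π) = weight F π
  term (Fin.suc l , π) = - weight (Fₗ l) π

  ι : Fin (suc p) × MultiPerm sh → Fin (suc p) × MultiPerm sh
  ι (Fin.zero  , π) = Fin.suc (pivot π) , π
  ι (Fin.suc l , π) with l Fin.≟ pivot π
  ... | yes _ = Fin.zero , π
  ... | no _  = Fin.suc (pivot π) , postcomposeColumn j (transpose l (pivot π)) π

  open Setoid Index using () renaming (_≈_ to _≈ᵢ_)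

  term-cong : ∀ {x y} → x ≈ᵢ y → term x ≡ term y
  term-cong {Fin.zero  , _} (refl , π≗π′) = weight-cong F π≗π′
  term-cong {Fin.suc l , _} (refl , π≗π′) = cong -_ (weight-cong (Fₗ l) π≗π′)

  ι-closed : ∀ x → IsIndex x → IsIndex (ι x)
  ι-closed (Fin.zero  , π) π-inj = π-inj
  ι-closed (Fin.suc l , π) π-inj with l Fin.≟ pivot π
  ... | yes _ = π-inj
  ... | no _  = postcomposeColumn-isMultiPerm j _ π (transpose-injective l (pivot π)) π-inj

  ι-cong : ∀ x {y} → IsIndex x → x ≈ᵢ y → ι x ≈ᵢ ι y
  ι-cong (Fin.zero  , π) π-inj (refl , π≗π′) = cong Fin.suc (pivot-cong π-inj π≗π′) , π≗π′
  ι-cong (Fin.suc l , π) {_ , π′} π-inj (refl , π≗π′) with l Fin.≟ pivot π | l Fin.≟ pivot π′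
  ... | yes _   | yes _   = refl , π≗π′
  ... | yes l≡m | no l≢m′ = ⊥-elim (l≢m′ (trans l≡m (pivot-cong π-inj π≗π′)))
  ... | no l≢m  | yes l≡m′ = ⊥-elim (l≢m (trans l≡m′ (sym (pivot-cong π-inj π≗π′))))
  ... | no _    | no _    = cong Fin.suc (pivot-cong π-inj π≗π′) ,
    postcomposeColumn-cong j (λ r → cong (λ m → transpose l m r) (pivot-cong π-inj π≗π′)) π≗π′

  ι-involutive : ∀ x → IsIndex x → ι (ι x) ≈ᵢ x
  ι-involutive (Fin.zero , π) π-inj with pivot π Fin.≟ pivot π
  ... | yes _   = refl , λ c r → refl
  ... | no m≢m = ⊥-elim (m≢m refl)
  ι-involutive (Fin.suc l , π) π-inj with l Fin.≟ pivot π
  ... | yes l≡m = cong Fin.suc (sym l≡m) , λ c r → refl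
  ... | no l≢m with pivot π Fin.≟ pivot (postcomposeColumn j (transpose l (pivot π)) π)
  ...   | yes m≡l = ⊥-elim (l≢m (sym (trans m≡l (pivot-postcompose l π-inj))))
  ...   | no _    = cong Fin.suc (pivot-postcompose l π-inj) , undo
    where
    π′ = postcomposeColumn j (transpose l (pivot π)) π
    undo : postcomposeColumn j (transpose (pivot π) (pivot π′)) π′ ≗ᵐ π
    undo c r = cases (c Fin.≟ j)
      where
      open ≡.≡-Reasoning
      cases : Dec (c ≡ j) → postcomposeColumn j (transpose (pivot π) (pivot π′)) π′ c r ≡ π c r
      cases (yes refl) = begin
        postcomposeColumn j (transpose (pivot π) (pivot π′)) π′ j r ≡⟨ postcomposeColumn-here j _ π′ r ⟩
        transpose (pivot π) (pivot π′) (π′ j r)                    ≡⟨ cong (λ k → transpose (pivot π) k (π′ j r)) (pivot-postcompose l π-inj) ⟩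
        transpose (pivot π) l (π′ j r)                             ≡⟨ cong (transpose (pivot π) l) (postcomposeColumn-here j _ π r) ⟩
        transpose (pivot π) l (transpose l (pivot π) (π j r))      ≡⟨ transpose-inverse (pivot π) l ⟩
        π j r ∎
      cases (no c≢j) = trans (postcomposeColumn-elsewhere j _ π′ c≢j r) (postcomposeColumn-elsewhere j _ π c≢j r)

  ι-fixpointFree : ∀ x → IsIndex x → ¬ ι x ≈ᵢ x
  ι-fixpointFree (Fin.zero  , π) _ (() , _)
  ι-fixpointFree (Fin.suc l , π) _ with l Fin.≟ pivot π
  ... | yes _   = λ { (() , _) }
  ... | no l≢m = λ (m≡l , _) → l≢m (sym (FinP.suc-injective m≡l))

  term-ι : ∀ x → IsIndex x → term (ι x) ≡ - term x
  term-ι (Fin.zero  , π) π-inj = cong -_ (weight-pivot π-inj)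
  term-ι (Fin.suc l , π) π-inj with l Fin.≟ pivot π
  ... | yes refl = trans (sym (weight-pivot π-inj)) (sym (ℤP.neg-involutive _))
  ... | no l≢m   = cong -_ (weight-transpose π-inj l≢m)

  indices-enumerate : Enumerates Index IsIndex (cartesianProduct (allFin (suc p)) (multiPerms sh))
  indices-enumerate = cartesianProductWith-enumerates _,_ (λ x≡y π≈π′ → x≡y , π≈π′) (λ x → x) (λ _ π-inj → π-inj)
    (λ {(x , π)} π-inj → x , π , tt , π-inj , refl , (λ c r → refl))
    (allFin-enumerates (suc p)) (multiPerms-enumerates sh)

  open SignReversingInvolution Index IsIndex term ι term-cong ι-closed ι-cong ι-involutive ι-fixpointFree term-ι

  plücker-relation : R F S - sumℤ (map (λ l → R (Fₗ l) S) (allFin p)) ≡ 0ℤ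
  plücker-relation = begin
    R F S - sumℤ (map (λ l → R (Fₗ l) S) (allFin p))
      ≡⟨ cong (ℤ._+_ (R F S)) (sumℤ-map-neg (λ l → R (Fₗ l) S) (allFin p)) ⟨
    R F S ℤ.+ sumℤ (map (λ l → - R (Fₗ l) S) (allFin p))
      -- allFin (suc p) unfolds to zero ∷ tabulate suc, and the zero block is R F S
      ≡⟨ cong (λ xs → R F S ℤ.+ sumℤ xs) (begin
           map (λ l → - R (Fₗ l) S) (allFin p)  ≡⟨ List.map-tabulate (λ l → l) _ ⟩
           tabulate (λ l → - R (Fₗ l) S)         ≡⟨ List.tabulate-cong (λ l → sumℤ-map-neg (weight (Fₗ l)) MP) ⟨
           tabulate (blockSum ∘ Fin.suc)         ≡⟨ List.map-tabulate Fin.suc blockSum ⟨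
           map blockSum (tabulate Fin.suc) ∎) ⟩
    sumℤ (map blockSum (allFin (suc p)))
      ≡⟨ sumℤ-cartesianProductWith term _,_ (allFin (suc p)) MP ⟨
    sumℤ (map term (cartesianProduct (allFin (suc p)) MP))
      ≡⟨ sumℤ≡0 indices-enumerate ⟩
    0ℤ ∎
    where
    open ≡.≡-Reasoning
    MP = multiPerms sh
    blockSum : Fin (suc p) → ℤ
    blockSum x = sumℤ (map (term ∘ (x ,_)) MP)

theorem3p20 : (n : ℕ) → 2 ≤ n → (sh : Partition) → (z : Fin n → ℕ) → ∣ z ∣ᶜ ≡ size sh →
    (F S : Filling n sh) → Cardinal F → Cardinal S →
    (∀ v → content F v ≡ z v) → (∀ v → content S v ≡ z v) →
    (j j′ : Fin (cols sh)) → toℕ j′ ≡ suc (toℕ j) →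
    R F S - sumℤ (map (λ l → R (exchange F j j′ l (top sh j′)) S) (allFin (ζ sh j))) ≡ 0ℤ
theorem3p20 _ _ _ _ _ F S _ _ _ _ _ _ j′≡1+j = PlückerRelation.plücker-relation F S j′≡1+j
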